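{- Let $S$ be a special numerical semigroup with genus $g>3$. If $S$ is neither irreducible nor ordinary, then there exists $n\in\mathbb{N}$ with $2\le n<g-1$ such that $S=\{0\}\cup\{g,g+1,\ldots,g+n-2\}\cup\{x\in\mathbb{N}\mid x\ge g+n\}$; in particular $S$ is almost-ordinary.
   Context: $\mathbb{N}=\{0,1,2,\ldots\}$. A numerical semigroup is a submonoid $S$ of $(\mathbb{N},+)$ with $\mathbb{N}\setminus S$ finite. $\operatorname{H}(S)=\mathbb{N}\setminus S$; genus $\operatorname{g}(S)=|\operatorname{H}(S)|$; $\operatorname{F}(S)=\max\operatorname{H}(S)$; $\operatorname{m}(S)=\min(S\setminus\{0\})$. Special gaps: $\operatorname{SG}(S)=\{h\in\operatorname{H}(S)\mid 2h\in S \text{ and } h+s\in S \text{ for all } s\in S\setminus\{0\}\}$. $S$ is special if there is no $h\in\operatorname{SG}(S)\setminus\{\operatorname{F}(S)\}$ with $h>\operatorname{m}(S)$. $S$ is irreducible if it cannot be written as the intersection of two numerical semigroups properly containing $S$. $S$ is ordinary if $S=\{0\}\cup\{x\in\mathbb{N}\mid x\ge c\}$ for some $c\in\mathbb{N}$. $S$ is almost-ordinary if $S=\{0\}\cup\{g,\ldots,g+n-2\}\cup\{x\in\mathbb{N}\mid x\ge g+n\}$ for some integers $g>2$ and $n\in[2,g]$. -}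

module Defs where

open import Data.Nat using (ℕ; zero; suc; _+_; _∸_; _≤_; _<_)
open import Data.Bool using (Bool; true; false)
open import Data.Product using (Σ; ∃; _×_; _,_)
open import Data.Sum using (_⊎_)
open import Data.List using (List; length)
open import Data.List.Membership.Propositional using (_∈_)
open import Data.List.Relation.Unary.Unique.Propositional using (Unique)
open import Relation.Nullary using (¬_)
open import Relation.Binary.PropositionalEquality using (_≡_; _≢_)
open import Function.Bundles using (_⇔_)

-- A subset of ℕ is represented by its (decidable) characteristic function.
-- (Every numerical semigroup is cofinite, hence decidable, so this loses nothing.)
Subsetℕ : Set
Subsetℕ = ℕ → Bool

_∈S_ : ℕ → Subsetℕ → Set
x ∈S S = S x ≡ true

_∉S_ : ℕ → Subsetℕ → Set
x ∉S S = S x ≡ false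

record IsNumericalSemigroup (S : Subsetℕ) : Set where
  field
    zero∈   : 0 ∈S S
    +-closed : ∀ x y → x ∈S S → y ∈S S → (x + y) ∈S S
    cofinite : ∃ λ c → ∀ x → c ≤ x → x ∈S S

HasGenus : Subsetℕ → ℕ → Set
HasGenus S g = Σ (List ℕ) λ L →
  Unique L × (∀ x → (x ∈ L) ⇔ (x ∉S S)) × length L ≡ g

IsFrobenius : Subsetℕ → ℕ → Set
IsFrobenius S f = f ∉S S × (∀ x → f < x → x ∈S S)

IsMultiplicity : Subsetℕ → ℕ → Set
IsMultiplicity S m = 0 < m × m ∈S S × (∀ x → 0 < x → x < m → x ∉S S)

IsSpecialGap : Subsetℕ → ℕ → Set
IsSpecialGap S h = h ∉S S × (h + h) ∈S S × (∀ s → s ∈S S → 0 < s → (h + s) ∈S S)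

IsSpecial : Subsetℕ → Set
IsSpecial S = ∀ h f m → IsFrobenius S f → IsMultiplicity S m →
  IsSpecialGap S h → h ≢ f → ¬ (m < h)

_⊂S_ : Subsetℕ → Subsetℕ → Set
S ⊂S T = (∀ x → x ∈S S → x ∈S T) × (∃ λ x → x ∈S T × x ∉S S)

IsIrreducible : Subsetℕ → Set
IsIrreducible S = ¬ (Σ Subsetℕ λ T → Σ Subsetℕ λ U →
  IsNumericalSemigroup T × IsNumericalSemigroup U × S ⊂S T × S ⊂S U ×
  (∀ x → x ∈S S ⇔ (x ∈S T × x ∈S U)))

IsOrdinary : Subsetℕ → Set
IsOrdinary S = ∃ λ c → ∀ x → x ∈S S ⇔ (x ≡ 0 ⊎ c ≤ x)

HasAlmostOrdinaryShape : Subsetℕ → ℕ → ℕ → Set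
HasAlmostOrdinaryShape S g n = ∀ x → x ∈S S ⇔
  (x ≡ 0 ⊎ (g ≤ x × x ≤ g + n ∸ 2) ⊎ g + n ≤ x)

IsAlmostOrdinary : Subsetℕ → Set
IsAlmostOrdinary S = Σ ℕ λ g → Σ ℕ λ n →
  2 < g × 2 ≤ n × n ≤ g × HasAlmostOrdinaryShape S g n

-- Since S is not irreducible it has a special gap h ≠ F, and since S is special, h < m.
-- If there were a gap strictly between m and F, the largest such gap x would itself be
-- special: for t ≥ m the only candidate failure is x + t = F, and then F − h (a gap,
-- because h is special) is a larger gap between m and F. This contradicts speciality,
-- so the gaps are exactly 1, …, m − 1 and F: the genus is m and S has the almost-ordinary
-- shape with n = F − m + 1. Finally F − h < m and h + h ≠ F force F ≤ 2m − 3, i.e. n < g − 1.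
module Submission where

open import Defs
open import Data.Bool using (true; false)
import Data.Bool as Bool
open import Data.Bool.Properties using (¬-not)
open import Data.Nat
open import Data.Nat.Properties
open import Data.Product using (Σ; ∃; _×_; _,_; proj₁; proj₂)
open import Data.Sum using (_⊎_; inj₁; inj₂)
open import Data.Empty using (⊥; ⊥-elim)
open import Data.List using (List; []; _∷_; length; upTo)
open import Data.List.Properties using (length-upTo)
open import Data.List.Membership.Propositional using (_∈_)
open import Data.List.Membership.Propositional.Properties using (∈-upTo⁺; ∈-upTo⁻)
open import Data.List.Membership.Propositional.Properties.WithK using (unique∧set⇒bag)
open import Data.List.Relation.Unary.Any using (here; there)
import Data.List.Relation.Unary.All as All
open import Data.List.Relation.Unary.AllPairs using (_∷_)
open import Data.List.Relation.Unary.Unique.Propositional using (Unique)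
open import Data.List.Relation.Unary.Unique.Propositional.Properties using (upTo⁺)
open import Data.List.Relation.Binary.BagAndSetEquality using (∼bag⇒↭)
open import Data.List.Relation.Binary.Permutation.Propositional.Properties using (↭-length)
open import Function using (_∘_)
open import Function.Bundles using (_⇔_; mk⇔; Equivalence)
open import Relation.Binary.Definitions using (tri<; tri≈; tri>)
open import Relation.Binary.PropositionalEquality
open import Relation.Nullary using (¬_; Dec; yes; no)
open import Relation.Nullary.Decidable using (_×-dec_; _⊎-dec_; decidable-stable)
open import Relation.Nullary.Negation using (¬¬-map)
open import Relation.Unary using (Pred; Decidable)

open Equivalence using (to; from)

module _ {p} {P : Pred ℕ p} (P? : Decidable P) where

  least-witness-below : ∀ v → (∃ λ n → n < v × P n) → ∃ λ k → P k × (∀ z → P z → k ≤ z)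
  least-witness-below (suc v) (n , n<1+v , Pn) with anyUpTo? P? v
  ... | yes smaller = least-witness-below v smaller
  ... | no none     = n , Pn , λ z Pz → ≮⇒≥ λ z<n → none (z , <-≤-trans z<n (s≤s⁻¹ n<1+v) , Pz)

  least-witness : ∀ {n} → P n → ∃ λ k → P k × (∀ z → P z → k ≤ z)
  least-witness {n} Pn = least-witness-below (suc n) (n , ≤-refl , Pn)

  greatest-witness : ∀ {n} B → P n → (∀ z → P z → z ≤ B) → ∃ λ k → P k × (∀ z → P z → z ≤ k)
  greatest-witness B Pn bounded with P? B
  ... | yes PB = B , PB , bounded
  greatest-witness zero    Pn bounded | no ¬P0 = ⊥-elim (¬P0 (subst P (n≤0⇒n≡0 (bounded _ Pn)) Pn))
  greatest-witness (suc B) Pn bounded | no ¬PB =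
    greatest-witness B Pn λ z Pz → s≤s⁻¹ (≤∧≢⇒< (bounded z Pz) λ { refl → ¬PB Pz })

<⇔≤∸1 : ∀ {m n} → 0 < n → m < n ⇔ m ≤ n ∸ 1
<⇔≤∸1 {n = suc n} _ = mk⇔ s≤s⁻¹ s≤s

unique∧set⇒length≡ : ∀ {a} {A : Set a} {xs ys : List A} → Unique xs → Unique ys →
  (∀ {x} → x ∈ xs ⇔ x ∈ ys) → length xs ≡ length ys
unique∧set⇒length≡ xs! ys! xs≈ys = ↭-length (∼bag⇒↭ (unique∧set⇒bag xs! ys! xs≈ys))

m<n<o∧o+m≢n+n⇒2+m<o : ∀ {m n o} → m < n → n < o → o + m ≢ n + n → 2 + m < o
m<n<o∧o+m≢n+n⇒2+m<o {m} {n} {o} m<n n<o o+m≢n+n = ≤∧≢⇒< (≤-trans (s≤s m<n) n<o) 2+m≢o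
  where
  2+m≢o : 2 + m ≢ o
  2+m≢o 2+m≡o = o+m≢n+n (begin
    o + m           ≡⟨ cong (_+ m) (sym 2+m≡o) ⟩
    suc (suc m + m) ≡⟨ cong suc (sym (+-suc m m)) ⟩
    suc m + suc m   ≡⟨ cong (λ k → k + k) (sym n≡1+m) ⟩
    n + n           ∎)
    where
    open ≡-Reasoning
    n≡1+m : n ≡ suc m
    n≡1+m = ≤-antisym (s≤s⁻¹ (subst (n <_) (sym 2+m≡o) n<o)) m<n

_∈S?_ : ∀ x A → Dec (x ∈S A)
x ∈S? A = A x Bool.≟ true

_∉S?_ : ∀ x A → Dec (x ∉S A)
x ∉S? A = A x Bool.≟ false

module _ {S : Subsetℕ} where

  ∈S⇒¬∉S : ∀ {x} → x ∈S S → ¬ x ∉S S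
  ∈S⇒¬∉S x∈ x∉ with () ← trans (sym x∈) x∉

  ¬∉S⇒∈S : ∀ {x} → ¬ x ∉S S → x ∈S S
  ¬∉S⇒∈S = ¬-not

  ¬∈S⇒∉S : ∀ {x} → ¬ x ∈S S → x ∉S S
  ¬∈S⇒∉S = ¬-not

  frobenius-gap⇒≤ : ∀ {F x} → IsFrobenius S F → x ∉S S → x ≤ F
  frobenius-gap⇒≤ (_ , above) x∉ = ≮⇒≥ λ F<x → ∈S⇒¬∉S (above _ F<x) x∉

  multiplicity-≤ : ∀ {m s} → IsMultiplicity S m → s ∈S S → 0 < s → m ≤ s
  multiplicity-≤ (_ , _ , below) s∈ 0<s = ≮⇒≥ λ s<m → ∈S⇒¬∉S s∈ (below _ 0<s s<m)

  specialGap-complement : ∀ {F h} → F ∉S S → IsSpecialGap S h → h < F → (F ∸ h) ∉S S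
  specialGap-complement F∉ (_ , _ , h+s∈) h<F = ¬∈S⇒∉S λ F∸h∈ →
    ∈S⇒¬∉S (subst (_∈S S) (m+[n∸m]≡n (<⇒≤ h<F)) (h+s∈ _ F∸h∈ (m<n⇒0<n∸m h<F))) F∉

  specialGap≢F⇒<m : IsSpecial S → ∀ {F m h} → IsFrobenius S F → IsMultiplicity S m →
    IsSpecialGap S h → h ≢ F → h < m
  specialGap≢F⇒<m special {F} {m} {h} frob mult sg h≢F with <-cmp h m
  ... | tri< h<m _ _  = h<m
  ... | tri≈ _ refl _ = ⊥-elim (∈S⇒¬∉S (proj₁ (proj₂ mult)) (proj₁ sg))
  ... | tri> _ _ m<h  = ⊥-elim (special h F m frob mult sg h≢F m<h)

  genus>0⇒gap : ∀ {g} → HasGenus S g → 0 < g → ∃ λ y → y ∉S S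
  genus>0⇒gap ([] , _ , _ , refl) ()
  genus>0⇒gap (y ∷ _ , _ , L-gaps , _) _ = y , to (L-gaps y) (here refl)

  module _ (ns : IsNumericalSemigroup S) where

    open IsNumericalSemigroup ns

    gap⇒>0 : ∀ {x} → x ∉S S → 0 < x
    gap⇒>0 {zero}  0∉ = ⊥-elim (∈S⇒¬∉S zero∈ 0∉)
    gap⇒>0 {suc x} _  = z<s

    gaps-bounded : ∃ λ B → ∀ x → x ∉S S → x ≤ B
    gaps-bounded with c , above ← cofinite =
      c , λ x x∉ → <⇒≤ (≰⇒> λ c≤x → ∈S⇒¬∉S (above x c≤x) x∉)

    frobenius-exists : ∀ {y} → y ∉S S → ∃ (IsFrobenius S)
    frobenius-exists y∉
      with F , F∉ , maximal ← greatest-witness (_∉S? S) _ y∉ (proj₂ gaps-bounded) =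
      F , F∉ , λ x F<x → ¬∉S⇒∈S λ x∉ → <⇒≱ F<x (maximal x x∉)

    multiplicity-exists : ∃ (IsMultiplicity S)
    multiplicity-exists with m , (0<m , m∈) , minimal ←
      least-witness (λ x → (0 <? x) ×-dec (x ∈S? S)) (z<s , proj₂ cofinite _ (n≤1+n _)) =
      m , 0<m , m∈ , λ x 0<x x<m → ¬∈S⇒∉S λ x∈ → <⇒≱ x<m (minimal x (0<x , x∈))

    -- The largest element of T ∖ S is a special gap of S.
    specialGap-of-⊂ : ∀ {T} → IsNumericalSemigroup T → S ⊂S T → ∃ λ h → IsSpecialGap S h × h ∈S T
    specialGap-of-⊂ {T} nsT (S⊆T , y , y∈T , y∉S)
      with h , (h∉S , h∈T) , maximal ← greatest-witness (λ z → (z ∉S? S) ×-dec (z ∈S? T)) _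
             (y∉S , y∈T) (λ z → proj₂ gaps-bounded z ∘ proj₁) =
      h , (h∉S , h+t∈S h (gap⇒>0 h∉S) h∈T , λ s s∈S 0<s → h+t∈S s 0<s (S⊆T s s∈S)) , h∈T
      where
      h+t∈S : ∀ t → 0 < t → t ∈S T → (h + t) ∈S S
      h+t∈S t 0<t t∈T = ¬∉S⇒∈S λ h+t∉S → <⇒≱ (m<m+n h 0<t)
        (maximal (h + t) (h+t∉S , IsNumericalSemigroup.+-closed nsT h t h∈T t∈T))

    ¬irreducible⇒¬¬specialGap≢F : ∀ {F} → F ∉S S → ¬ IsIrreducible S →
      ¬ ¬ (∃ λ h → IsSpecialGap S h × h ≢ F)
    ¬irreducible⇒¬¬specialGap≢F {F} F∉ ¬irreducible none =
      ¬irreducible λ (T , U , nsT , nsU , S⊂T , S⊂U , S≡T∩U) →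
        let h₁ , sg₁ , h₁∈T = specialGap-of-⊂ nsT S⊂T
            h₂ , sg₂ , h₂∈U = specialGap-of-⊂ nsU S⊂U
            F∈T = subst (_∈S T) (≡F sg₁) h₁∈T
            F∈U = subst (_∈S U) (≡F sg₂) h₂∈U
        in ∈S⇒¬∉S (from (S≡T∩U F) (F∈T , F∈U)) F∉
      where
      ≡F : ∀ {h} → IsSpecialGap S h → h ≡ F
      ≡F {h} sg = decidable-stable (h ≟ F) λ h≢F → none (h , sg , h≢F)

    ¬ordinary⇒m<F : ∀ {F m} → IsFrobenius S F → IsMultiplicity S m → ¬ IsOrdinary S → m < F
    ¬ordinary⇒m<F {F} {m} (F∉ , above) mult@(_ , m∈ , _) ¬ordinary =
      ≰⇒> λ F≤m → ¬ordinary (m , λ x → mk⇔ ordinary-to (ordinary-from (≤∧≢⇒< F≤m F≢m)))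
      where
      F≢m : F ≢ m
      F≢m refl = ∈S⇒¬∉S m∈ F∉
      ordinary-to : ∀ {x} → x ∈S S → x ≡ 0 ⊎ m ≤ x
      ordinary-to {zero}  _  = inj₁ refl
      ordinary-to {suc x} x∈ = inj₂ (multiplicity-≤ mult x∈ z<s)
      ordinary-from : F < m → ∀ {x} → x ≡ 0 ⊎ m ≤ x → x ∈S S
      ordinary-from _   (inj₁ refl) = zero∈
      ordinary-from F<m (inj₂ m≤x)  = above _ (<-≤-trans F<m m≤x)

    module _ {F m : ℕ} (frob : IsFrobenius S F) (mult : IsMultiplicity S m)
             (m<F : m < F) (gaps : ∀ {x} → x ∉S S → x < m ⊎ x ≡ F) where

      private
        F∉ = proj₁ frob

      -- Adjoining 0 to the list of gaps yields the same set as F ∷ upTo m.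
      genus≡multiplicity : ∀ {g} → HasGenus S g → g ≡ m
      genus≡multiplicity {g} (L , L! , L-gaps , |L|≡g) = suc-injective (begin
        suc g                  ≡⟨ cong suc |L|≡g ⟨
        length (0 ∷ L)         ≡⟨ unique∧set⇒length≡ 0∷L! F∷upTo! same-elements ⟩
        length (F ∷ upTo m)    ≡⟨ cong suc (length-upTo m) ⟩
        suc m                  ∎)
        where
        open ≡-Reasoning
        0∷L! : Unique (0 ∷ L)
        0∷L! = All.tabulate (λ x∈L 0≡x →
          ∈S⇒¬∉S zero∈ (subst (_∉S S) (sym 0≡x) (to (L-gaps _) x∈L))) ∷ L!
        F∷upTo! : Unique (F ∷ upTo m)
        F∷upTo! = All.tabulate (λ x∈ F≡x →
          <-asym m<F (subst (_< m) (sym F≡x) (∈-upTo⁻ x∈))) ∷ upTo⁺ m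
        same-elements : ∀ {x} → x ∈ 0 ∷ L ⇔ x ∈ F ∷ upTo m
        same-elements {x} = mk⇔ forth back
          where
          forth : x ∈ 0 ∷ L → x ∈ F ∷ upTo m
          forth (here refl) = there (∈-upTo⁺ (proj₁ mult))
          forth (there x∈L) with gaps (to (L-gaps x) x∈L)
          ... | inj₁ x<m  = there (∈-upTo⁺ x<m)
          ... | inj₂ refl = here refl
          back : x ∈ F ∷ upTo m → x ∈ 0 ∷ L
          back (here refl) = there (from (L-gaps F) F∉)
          back (there x∈) with x ≟ 0
          ... | yes x≡0 = here x≡0
          ... | no x≢0  = there (from (L-gaps x) (proj₂ (proj₂ mult) x (n≢0⇒n>0 x≢0) (∈-upTo⁻ x∈)))

      almostOrdinaryShape : HasAlmostOrdinaryShape S m (suc (F ∸ m))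
      almostOrdinaryShape x rewrite +-suc m (F ∸ m) | m+[n∸m]≡n (<⇒≤ m<F) = mk⇔ shape-to shape-from
        where
        below-F : x < F ⇔ x ≤ F ∸ 1
        below-F = <⇔≤∸1 (<-≤-trans z<s m<F)
        shape-to : x ∈S S → x ≡ 0 ⊎ (m ≤ x × x ≤ F ∸ 1) ⊎ suc F ≤ x
        shape-to x∈ with x ≟ 0 | <-cmp x F
        ... | yes x≡0 | _            = inj₁ x≡0
        ... | no x≢0  | tri< x<F _ _ = inj₂ (inj₁ (multiplicity-≤ mult x∈ (n≢0⇒n>0 x≢0) , to below-F x<F))
        ... | no _    | tri≈ _ refl _ = ⊥-elim (∈S⇒¬∉S x∈ F∉)
        ... | no _    | tri> _ _ F<x = inj₂ (inj₂ F<x)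
        shape-from : x ≡ 0 ⊎ (m ≤ x × x ≤ F ∸ 1) ⊎ suc F ≤ x → x ∈S S
        shape-from (inj₁ refl)               = zero∈
        shape-from (inj₂ (inj₂ F<x))         = proj₂ frob x F<x
        shape-from (inj₂ (inj₁ (m≤x , x≤F∸1))) = ¬∉S⇒∈S λ x∉ → case-gap (gaps x∉)
          where
          case-gap : x < m ⊎ x ≡ F → ⊥
          case-gap (inj₁ x<m)  = <⇒≱ x<m m≤x
          case-gap (inj₂ refl) = <-irrefl refl (from below-F x≤F∸1)

    module SmallSpecialGap (special : IsSpecial S) {F m : ℕ} (frob : IsFrobenius S F) (mult : IsMultiplicity S m)
             {h : ℕ} (sg : IsSpecialGap S h) (h<m : h < m) where

      private
        F∉ = proj₁ frob
        0<h = gap⇒>0 (proj₁ sg)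

        InnerGap : ℕ → Set
        InnerGap z = z ∉S S × m < z × z < F

        innerGap? : Decidable InnerGap
        innerGap? z = (z ∉S? S) ×-dec (m <? z) ×-dec (z <? F)

      greatest-innerGap-special : ∀ {x} → InnerGap x → (∀ z → InnerGap z → z ≤ x) → IsSpecialGap S x
      greatest-innerGap-special {x} (x∉ , m<x , x<F) maximal =
        x∉ , x+t∈ x (<⇒≤ m<x) , λ s s∈ 0<s → x+t∈ s (multiplicity-≤ mult s∈ 0<s)
        where
        x+t∈ : ∀ t → m ≤ t → (x + t) ∈S S
        x+t∈ t m≤t with <-cmp (x + t) F
        ... | tri> _ _ F<x+t = proj₂ frob _ F<x+t
        ... | tri< x+t<F _ _ = ¬∉S⇒∈S λ x+t∉ → <⇒≱ (m<m+n x (<-≤-trans (proj₁ mult) m≤t))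
                (maximal (x + t) (x+t∉ , <-≤-trans m<x (m≤m+n x t) , x+t<F))
        ... | tri≈ _ x+t≡F _ = ⊥-elim (<⇒≱ x<F∸h (maximal (F ∸ h) (F∸h∉ , <-trans m<x x<F∸h , F∸h<F)))
          where
          h<F : h < F
          h<F = <-trans h<m (<-trans m<x x<F)
          F∸h∉ : (F ∸ h) ∉S S
          F∸h∉ = specialGap-complement F∉ sg h<F
          F∸h<F : F ∸ h < F
          F∸h<F = ∸-monoʳ-< 0<h (<⇒≤ h<F)
          x<F∸h : x < F ∸ h
          x<F∸h = m+n≤o⇒m≤o∸n (suc x) (subst (x + h <_) x+t≡F (+-monoʳ-< x (<-≤-trans h<m m≤t)))

      no-gap-between-m-and-F : ∀ {y} → y ∉S S → m < y → y < F → ⊥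
      no-gap-between-m-and-F y∉ m<y y<F
        with x , x-inner@(_ , m<x , x<F) , maximal ←
             greatest-witness innerGap? F (y∉ , m<y , y<F) (λ _ → <⇒≤ ∘ proj₂ ∘ proj₂) =
        special x F m frob mult (greatest-innerGap-special x-inner maximal) (<⇒≢ x<F) m<x

      gap⇒<m⊎≡F : ∀ {x} → x ∉S S → x < m ⊎ x ≡ F
      gap⇒<m⊎≡F {x} x∉ with x <? m | x ≟ F
      ... | yes x<m | _       = inj₁ x<m
      ... | no _    | yes x≡F = inj₂ x≡F
      ... | no x≮m  | no x≢F  =
        ⊥-elim (no-gap-between-m-and-F x∉ m<x (≤∧≢⇒< (frobenius-gap⇒≤ frob x∉) x≢F))
        where
        m<x : m < x
        m<x = ≤∧≢⇒< (≮⇒≥ x≮m) λ { refl → ∈S⇒¬∉S (proj₁ (proj₂ mult)) x∉ }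

      2+[F∸m]<m : m < F → 2 + (F ∸ m) < m
      2+[F∸m]<m m<F = m<n<o∧o+m≢n+n⇒2+m<o F∸m<h h<m m+[F∸m]≢h+h
        where
        h<F = <-trans h<m m<F
        m+[F∸m]≡F : m + (F ∸ m) ≡ F
        m+[F∸m]≡F = m+[n∸m]≡n (<⇒≤ m<F)
        F∸h<m : F ∸ h < m
        F∸h<m with gap⇒<m⊎≡F (specialGap-complement F∉ sg h<F)
        ... | inj₁ F∸h<m = F∸h<m
        ... | inj₂ F∸h≡F = ⊥-elim (<⇒≢ (∸-monoʳ-< 0<h (<⇒≤ h<F)) F∸h≡F)
        F∸m<h : F ∸ m < h
        F∸m<h = +-cancelˡ-< m _ _ (subst (_< m + h) (sym m+[F∸m]≡F)
          (≰⇒> λ m+h≤F → <⇒≱ F∸h<m (m+n≤o⇒m≤o∸n m m+h≤F)))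
        m+[F∸m]≢h+h : m + (F ∸ m) ≢ h + h
        m+[F∸m]≢h+h eq = ∈S⇒¬∉S (proj₁ (proj₂ sg)) (subst (_∉S S) (trans (sym m+[F∸m]≡F) eq) F∉)

    module Reducible (special : IsSpecial S) (¬irreducible : ¬ IsIrreducible S) (¬ordinary : ¬ IsOrdinary S)
                     {F m : ℕ} (frob : IsFrobenius S F) (mult : IsMultiplicity S m) where

      m<F : m < F
      m<F = ¬ordinary⇒m<F frob mult ¬ordinary

      -- The special gap below m is only available under a double negation; this suffices
      -- because everything derived from it below is decidable.
      ¬¬specialGap<m : ¬ ¬ (∃ λ h → IsSpecialGap S h × h < m)
      ¬¬specialGap<m = ¬¬-map (λ (h , sg , h≢F) → h , sg , specialGap≢F⇒<m special frob mult sg h≢F)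
        (¬irreducible⇒¬¬specialGap≢F (proj₁ frob) ¬irreducible)

      gaps : ∀ {x} → x ∉S S → x < m ⊎ x ≡ F
      gaps {x} x∉ = decidable-stable ((x <? m) ⊎-dec (x ≟ F))
        (¬¬-map (λ (_ , sg , h<m) → SmallSpecialGap.gap⇒<m⊎≡F special frob mult sg h<m x∉) ¬¬specialGap<m)

      2+[F∸m]<m : 2 + (F ∸ m) < m
      2+[F∸m]<m = decidable-stable (_ <? m)
        (¬¬-map (λ (_ , sg , h<m) → SmallSpecialGap.2+[F∸m]<m special frob mult sg h<m m<F) ¬¬specialGap<m)

      shape-at-multiplicity : Σ ℕ λ n → 2 ≤ n × n < m ∸ 1 × HasAlmostOrdinaryShape S m n
      shape-at-multiplicity = suc (F ∸ m) , s≤s (m<n⇒0<n∸m m<F) ,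
        to (<⇔≤∸1 (proj₁ mult)) 2+[F∸m]<m , almostOrdinaryShape frob mult m<F gaps

      genus≡m : ∀ {g} → HasGenus S g → g ≡ m
      genus≡m = genus≡multiplicity frob mult m<F gaps

corollary3p7 : (S : Subsetℕ) (g : ℕ) → IsNumericalSemigroup S → IsSpecial S →
    HasGenus S g → 3 < g → ¬ IsIrreducible S → ¬ IsOrdinary S →
    (Σ ℕ λ n → 2 ≤ n × n < g ∸ 1 × HasAlmostOrdinaryShape S g n) × IsAlmostOrdinary S
corollary3p7 S g ns special genus 3<g ¬irreducible ¬ordinary =
  let _ , y∉ = genus>0⇒gap {S} genus (<-trans z<s 3<g)
      F , frob = frobenius-exists ns y∉
      m , mult = multiplicity-exists ns
      open Reducible ns special ¬irreducible ¬ordinary frob mult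
      n , 2≤n , n<g∸1 , shape =
        subst (λ k → Σ ℕ λ n → 2 ≤ n × n < k ∸ 1 × HasAlmostOrdinaryShape S k n)
              (sym (genus≡m genus)) shape-at-multiplicity
      n≤g = ≤-trans (<⇒≤ n<g∸1) (m∸n≤m g 1)
  in (n , 2≤n , n<g∸1 , shape) , (g , n , <-trans (n<1+n 2) 3<g , 2≤n , n≤g , shape)
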